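{- Let $F$ be a uniformly sign-coherent ice quiver whose mutable subquiver is a fork with point of return $r$, and let $v_1\prec\dots\prec v_{n-1}$ be the unique acyclic ordering of the mutable subquiver minus $r$. For $j\le n-1$ let $F^j=\mu_{\mathbf w_j}(F)$ with $\mathbf w_j=[v_1,\dots,v_j]$, and $F^0=F$. (i) If $r$ is red in $F$, then $r$ can be any color (red, green or blue) in $F^j$. (ii) If $r$ is green in $F$, then $r$ remains green in $F^j$. (iii) If $r$ is blue in $F$, then $r$ is blue in $F^j$ only if no vertex $v_i$ is green in $F^{i-1}$ for all $i\le j$; otherwise $r$ is green in $F^j$. Furthermore, if $v_{n-1}$ is red in $F$, then $v_{n-1}$ is green in $F^{n-1}$ and is the only non-red vertex among the mutable vertices of $F^{n-1}$ other than $r$.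
   Context: Quivers have no loops or 2-cycles; $f_{ij}$ is the number of arrows $i\to j$, negative if arrows go $j\to i$. An ice quiver has vertices partitioned into mutable and frozen; its mutable subquiver is the full subquiver on mutable vertices. Mutation at a mutable vertex $k$: add an arrow $a\to b$ for each path $a\to k\to b$, reverse all arrows at $k$, remove 2-cycles; $\mu_{[i_1,\dots,i_m]}$ mutates at $i_1$ first, etc. A mutable vertex $i$ is green if it has at least one arrow to/from a frozen vertex and all such arrows go from $i$ to frozen vertices; red if at least one such arrow and all go from frozen vertices to $i$; blue if none. Uniformly sign-coherent: every ice quiver obtained by mutation sequences has every mutable vertex red, green or blue, and not every mutable vertex of the ice quiver itself is blue. Abundant: at least two arrows between every pair of distinct vertices; acyclic: no directed cycle. Acyclic ordering: total order $\prec$ with $v_i\prec v_j$ whenever $v_i\to v_j$. A fork is an abundant, non-acyclic quiver $F$ with a vertex $r$ (point of return) such that for all $i\in F^-(r)$ (vertices with arrows to $r$) and $j\in F^+(r)$ (vertices with arrows from $r$), $f_{ji}>f_{ir}$ and $f_{ji}>f_{rj}$, and $F\setminus\{r\}$ is acyclic. -}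

module Defs where

open import Data.Nat using (ℕ; zero; suc)
import Data.Nat as ℕ
open import Data.Integer using (ℤ; +_; -[1+_]; _+_; _*_; -_; ∣_∣; _<_; _≤_; 0ℤ)
open import Data.Fin using (Fin; punchIn; _≟_)
open import Data.Sum using (_⊎_; inj₁; inj₂)
open import Data.Product using (_×_; ∃)
open import Data.Bool using (Bool; true; false; if_then_else_; _∨_)
open import Data.List using (List; []; _∷_; map; take; allFin)
open import Relation.Nullary using (¬_; does)
open import Relation.Binary.PropositionalEquality using (_≡_; _≢_)
open import Function.Definitions using (Injective)

-- Quivers (no loops, no 2-cycles) on vertex set V are encoded by the
-- skew-symmetric integer matrix f, with f a b = number of arrows a → b
-- (negative if the arrows go b → a).

Quiver : ℕ → Set
Quiver n = Fin n → Fin n → ℤ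

-- Vertices of an ice quiver: n mutable vertices (inj₁) and m frozen ones (inj₂).
Vertex : ℕ → ℕ → Set
Vertex n m = Fin n ⊎ Fin m

IceQuiver : ℕ → ℕ → Set
IceQuiver n m = Vertex n m → Vertex n m → ℤ

-- Well-formedness: skew-symmetry (implies no loops; 2-cycles are not representable).
IsIceQuiver : ∀ {n m} → IceQuiver n m → Set
IsIceQuiver F = ∀ a b → F a b ≡ - F b a

mutableSub : ∀ {n m} → IceQuiver n m → Quiver n
mutableSub F i j = F (inj₁ i) (inj₁ j)

delete : ∀ {n} → Fin (suc n) → Quiver (suc n) → Quiver n
delete r Q i j = Q (punchIn r i) (punchIn r j)

-- Net number of arrows a → b created by paths a → k → b (x = f a k, y = f k b):
-- x*y new arrows a → b if x,y > 0; x*y new arrows b → a if x,y < 0; none otherwise.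
pathTerm : ℤ → ℤ → ℤ
pathTerm (+ suc a) (+ suc b) = + (suc a ℕ.* suc b)
pathTerm -[1+ a ] -[1+ b ] = - (+ (suc a ℕ.* suc b))
pathTerm _ _ = 0ℤ

isVertex : ∀ {n m} → Fin n → Vertex n m → Bool
isVertex k (inj₁ i) = does (k ≟ i)
isVertex k (inj₂ _) = false

-- Mutation at mutable vertex k (adding 2-cycles then cancelling them is the
-- integer addition below; reversing arrows at k is negation).
mutate : ∀ {n m} → Fin n → IceQuiver n m → IceQuiver n m
mutate k F a b =
  if isVertex k a ∨ isVertex k b
  then - F a b
  else F a b + pathTerm (F a (inj₁ k)) (F (inj₁ k) b)

mutateSeq : ∀ {n m} → List (Fin n) → IceQuiver n m → IceQuiver n m
mutateSeq [] F = F
mutateSeq (k ∷ ks) F = mutateSeq ks (mutate k F)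

Green : ∀ {n m} → IceQuiver n m → Fin n → Set
Green F i = (∃ λ j → + 0 < F (inj₁ i) (inj₂ j)) × (∀ j → + 0 ≤ F (inj₁ i) (inj₂ j))

Red : ∀ {n m} → IceQuiver n m → Fin n → Set
Red F i = (∃ λ j → F (inj₁ i) (inj₂ j) < + 0) × (∀ j → F (inj₁ i) (inj₂ j) ≤ + 0)

Blue : ∀ {n m} → IceQuiver n m → Fin n → Set
Blue F i = ∀ j → F (inj₁ i) (inj₂ j) ≡ + 0

UniformlySignCoherent : ∀ {n m} → IceQuiver n m → Set
UniformlySignCoherent F =
  (∀ (ks : List (Fin _)) i →
     Red (mutateSeq ks F) i ⊎ Green (mutateSeq ks F) i ⊎ Blue (mutateSeq ks F) i)
  × ¬ (∀ i → Blue F i)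

data Path {n} (Q : Quiver n) : Fin n → Fin n → Set where
  edge : ∀ {a b} → + 0 < Q a b → Path Q a b
  step : ∀ {a b c} → + 0 < Q a b → Path Q b c → Path Q a c

Acyclic : ∀ {n} → Quiver n → Set
Acyclic Q = ∀ a → ¬ Path Q a a

Abundant : ∀ {n} → Quiver n → Set
Abundant Q = ∀ i j → i ≢ j → 2 ℕ.≤ ∣ Q i j ∣

IsFork : ∀ {n} → Quiver (suc n) → Fin (suc n) → Set
IsFork Q r =
  Abundant Q × ¬ Acyclic Q
  × (∀ i j → + 0 < Q i r → + 0 < Q r j → (Q i r < Q j i) × (Q r j < Q j i))
  × Acyclic (delete r Q)

IsAcyclicOrdering : ∀ {n} → Quiver n → (Fin n → Fin n) → Set
IsAcyclicOrdering Q v =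
  Injective _≡_ _≡_ v × (∀ a b → + 0 < Q (v a) (v b) → a Data.Fin.< b)

-- The j-th vertex (0-based) of the ordering of F ∖ r, as a vertex of F.
ordVertex : ∀ {n} → Fin (suc n) → (Fin n → Fin n) → Fin n → Fin (suc n)
ordVertex r v i = punchIn r (v i)

stage : ∀ {n m} → IceQuiver (suc n) m → Fin (suc n) → (Fin n → Fin n) → ℕ → IceQuiver (suc n) m
stage {n} F r v j = mutateSeq (map (ordVertex r v) (take j (allFin n))) F

module Submission where

-- Mutating along the acyclic order of F ∖ r, each v_c is, at its turn, a source of F^c ∖ r with
-- at least two arrows to every other v_b (earlier mutations at sources only reverse arrows), and
-- r has arrows to v_c: to the first vertex by the fork condition, and later because the paths
-- r → v_c → v_b only add arrows r → v_b. Hence each mutation can only add arrows from r to frozen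
-- vertices, giving (ii) and (iii), and can only remove arrows from the other v_b to them; (i) is
-- uniform sign-coherence. A last vertex v_l that is red in F keeps nonpositive frozen arrows
-- until its turn, which makes it green. For an earlier v_i and frozen f, let g be the arrow
-- v_i → f at v_i's turn: afterwards that arrow is at most −g, and if g < 0 the arrow v_l → f
-- lost at least 2|g| then; the final mutation at v_l, which sends two or more arrows to v_i,
-- turns each arrow f → v_l into at least two arrows f → v_i, and this leaves v_i red.

open import Defs
open import Data.Nat using (ℕ; suc; _≤_; _<_)
open import Data.Fin using (Fin; toℕ)
open import Data.Sum using (_⊎_)
open import Data.Product using (_×_; ∃)
open import Relation.Nullary using (¬_)
open import Relation.Binary.PropositionalEquality using (_≡_; _≢_)

open import Data.Nat using (zero; z≤n; s≤s)
import Data.Nat as ℕ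
import Data.Nat.Properties as ℕP
import Data.Fin as Fin
open import Data.Fin using (fromℕ<; punchIn; punchOut) renaming (_≟_ to _≟ᶠ_)
import Data.Fin.Properties as FinP
open import Data.Integer using (ℤ; +_; -[1+_]; 0ℤ; ∣_∣; +≤+; -≤-; -≤+; +<+; -<+; nonNegative)
  renaming (_≤_ to _≤ᶻ_; _<_ to _<ᶻ_; _+_ to _+ᶻ_; -_ to -ᶻ_)
import Data.Integer.Properties as ℤP
open import Data.Sum using (inj₁; inj₂)
open import Data.Product using (_,_; proj₁; proj₂)
open import Data.Bool using (Bool; true; false; if_then_else_)
open import Data.Bool.Properties using (∨-zeroʳ)
open import Data.List using ([]; _∷_; _++_; map; take; tabulate; allFin)
open import Data.List.Properties using (map-++)
open import Relation.Nullary using (yes; no; does; contradiction)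
open import Relation.Nullary.Decidable using (dec-true; dec-false)
open import Relation.Binary.Definitions using (Reflexive; Transitive)
open import Relation.Binary.PropositionalEquality
  using (refl; sym; trans; cong; cong₂; subst; subst₂; module ≡-Reasoning)
open import Function using (_∘_; id; flip)
open import Function.Definitions using (Injective)

skew-zero : ∀ x → x ≡ -ᶻ x → x ≡ 0ℤ
skew-zero (+ zero) _ = refl

two-positive : ∀ {x} → + 2 ≤ᶻ x → + 0 <ᶻ x
two-positive = ℤP.<-≤-trans (+<+ (s≤s z≤n))

abundant-sign : ∀ x → 2 ℕ.≤ ∣ x ∣ → + 2 ≤ᶻ x ⊎ x ≤ᶻ -[1+ 1 ]
abundant-sign (+ suc (suc k)) _ = inj₁ (+≤+ (s≤s (s≤s z≤n)))
abundant-sign -[1+ suc k ] _ = inj₂ (-≤- (s≤s z≤n))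
abundant-sign (+ suc zero) (s≤s ())
abundant-sign -[1+ zero ] (s≤s ())

≤-+-nonneg : ∀ x {p} → + 0 ≤ᶻ p → x ≤ᶻ x +ᶻ p
≤-+-nonneg x {p} 0≤p = ℤP.i≤i+j x p {{nonNegative 0≤p}}

<-+-pos : ∀ x {p} → + 0 <ᶻ p → x <ᶻ x +ᶻ p
<-+-pos x {p} 0<p = subst (_<ᶻ x +ᶻ p) (ℤP.+-identityʳ x) (ℤP.+-monoʳ-< x 0<p)

+-nonpos-≤ : ∀ x {p} → p ≤ᶻ + 0 → x +ᶻ p ≤ᶻ x
+-nonpos-≤ x {p} p≤0 = subst (x +ᶻ p ≤ᶻ_) (ℤP.+-identityʳ x) (ℤP.+-monoʳ-≤ x p≤0)

negateIf : Bool → ℤ → ℤ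
negateIf s x = if s then -ᶻ x else x

negateIf-neg : ∀ s x → negateIf s (-ᶻ x) ≡ -ᶻ negateIf s x
negateIf-neg false x = refl
negateIf-neg true x = refl

pathTerm-nonneg : ∀ x y → + 0 <ᶻ x → + 0 ≤ᶻ pathTerm x y
pathTerm-nonneg (+ suc a) (+ zero) _ = +≤+ z≤n
pathTerm-nonneg (+ suc a) (+ suc b) _ = +≤+ z≤n
pathTerm-nonneg (+ suc a) -[1+ b ] _ = +≤+ z≤n
pathTerm-nonneg (+ zero) _ (+<+ ())

pathTerm-≥ʳ : ∀ x y → + 0 <ᶻ x → + 0 <ᶻ y → y ≤ᶻ pathTerm x y
pathTerm-≥ʳ (+ suc a) (+ suc b) _ _ = +≤+ (ℕP.m≤m+n (suc b) (a ℕ.* suc b))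
pathTerm-≥ʳ (+ zero) _ (+<+ ()) _
pathTerm-≥ʳ (+ suc a) (+ zero) _ (+<+ ())

pathTerm-nonpos : ∀ x y → x <ᶻ + 0 → pathTerm x y ≤ᶻ + 0
pathTerm-nonpos -[1+ a ] (+ b) _ = +≤+ z≤n
pathTerm-nonpos -[1+ a ] -[1+ b ] _ = -≤+
pathTerm-nonpos (+ a) _ (+<+ ())

pathTerm-zero : ∀ x y → x <ᶻ + 0 → + 0 ≤ᶻ y → pathTerm x y ≡ 0ℤ
pathTerm-zero -[1+ a ] (+ b) _ _ = refl
pathTerm-zero (+ a) _ (+<+ ()) _

pathTerm-≤-double : ∀ x y → x ≤ᶻ -[1+ 1 ] → y <ᶻ + 0 → pathTerm x y ≤ᶻ y +ᶻ y
pathTerm-≤-double -[1+ suc a ] -[1+ b ] _ _ =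
  -≤- (subst (ℕ._≤ b ℕ.+ suc a ℕ.* suc b) (ℕP.+-suc b b)
         (ℕP.+-monoʳ-≤ b (ℕP.m≤m+n (suc b) _)))
pathTerm-≤-double -[1+ suc a ] (+ b) _ (+<+ ())
pathTerm-≤-double -[1+ zero ] _ (-≤- ()) _

pathTerm-swap : ∀ x y → pathTerm (-ᶻ y) (-ᶻ x) ≡ -ᶻ pathTerm x y
pathTerm-swap (+ zero) (+ zero) = refl
pathTerm-swap (+ zero) (+ suc b) = refl
pathTerm-swap (+ zero) -[1+ b ] = refl
pathTerm-swap (+ suc a) (+ zero) = refl
pathTerm-swap (+ suc a) (+ suc b) = cong (λ k → -ᶻ (+ k)) (ℕP.*-comm (suc b) (suc a))
pathTerm-swap (+ suc a) -[1+ b ] = refl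
pathTerm-swap -[1+ a ] (+ zero) = refl
pathTerm-swap -[1+ a ] (+ suc b) = refl
pathTerm-swap -[1+ a ] -[1+ b ] = cong +_ (ℕP.*-comm (suc b) (suc a))

pathTerm-positive : ∀ x y a → + 0 <ᶻ x → + 0 <ᶻ a ⊎ (+ 0 <ᶻ y × -ᶻ a <ᶻ y) → + 0 <ᶻ a +ᶻ pathTerm x y
pathTerm-positive x y a 0<x (inj₁ 0<a) = ℤP.<-≤-trans 0<a (≤-+-nonneg a (pathTerm-nonneg x y 0<x))
pathTerm-positive x y a 0<x (inj₂ (0<y , -a<y)) =
  subst (_<ᶻ a +ᶻ pathTerm x y) (ℤP.+-inverseʳ a)
    (ℤP.+-monoʳ-< a (ℤP.<-≤-trans -a<y (pathTerm-≥ʳ x y 0<x 0<y)))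

-- The mutation at the last vertex v_l, seen from an earlier vertex v_i and a frozen f: a is the
-- arrow v_i → f, at most −g where g was that arrow when v_i itself was mutated; p is the arrow
-- v_i → v_l and y the arrow v_l → f.
nonpos-after-last-turn : ∀ a g p y → a ≤ᶻ -ᶻ g → p ≤ᶻ -[1+ 1 ] → y ≤ᶻ + 0 → (g <ᶻ + 0 → y ≤ᶻ g +ᶻ g)
  → (a +ᶻ pathTerm p y ≤ᶻ + 0) × (y <ᶻ + 0 → a +ᶻ pathTerm p y <ᶻ + 0)
nonpos-after-last-turn a g p y a≤-g p≤-2 y≤0 y≤2g with y ℤP.<? + 0
... | yes y<0 = ℤP.<⇒≤ negative , λ _ → negative
  where
  open ℤP.≤-Reasoning
  doubled : a +ᶻ (y +ᶻ y) <ᶻ + 0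
  doubled with g ℤP.<? + 0
  ... | yes g<0 = begin-strict
        a +ᶻ (y +ᶻ y)       ≤⟨ ℤP.+-mono-≤ a≤-g (ℤP.+-monoˡ-≤ y y≤g) ⟩
        -ᶻ g +ᶻ (g +ᶻ y)    ≡⟨ sym (ℤP.+-assoc (-ᶻ g) g y) ⟩
        -ᶻ g +ᶻ g +ᶻ y      ≡⟨ cong (_+ᶻ y) (ℤP.+-inverseˡ g) ⟩
        0ℤ +ᶻ y             ≡⟨ ℤP.+-identityˡ y ⟩
        y                   <⟨ y<0 ⟩
        + 0                 ∎
    where
    y≤g : y ≤ᶻ g
    y≤g = ℤP.≤-trans (y≤2g g<0) (+-nonpos-≤ g (ℤP.<⇒≤ g<0))
  ... | no g≮0 = begin-strict
        a +ᶻ (y +ᶻ y)   <⟨ ℤP.+-mono-≤-< (ℤP.≤-trans a≤-g (ℤP.neg-mono-≤ (ℤP.≮⇒≥ g≮0))) (ℤP.+-mono-< y<0 y<0) ⟩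
        + 0             ∎
  negative : a +ᶻ pathTerm p y <ᶻ + 0
  negative = ℤP.≤-<-trans (ℤP.+-monoʳ-≤ a (pathTerm-≤-double p y p≤-2 y<0)) doubled
... | no y≮0 = subst (_≤ᶻ + 0) (sym a+0≡a) a≤0 , λ y<0 → contradiction y<0 y≮0
  where
  a+0≡a : a +ᶻ pathTerm p y ≡ a
  a+0≡a = trans (cong (a +ᶻ_) (pathTerm-zero p y (ℤP.≤-<-trans p≤-2 -<+) (ℤP.≮⇒≥ y≮0))) (ℤP.+-identityʳ a)
  a≤0 : a ≤ᶻ + 0
  a≤0 with g ℤP.<? + 0
  ... | yes g<0 = contradiction (ℤP.≤-<-trans (y≤2g g<0) (ℤP.+-mono-< g<0 g<0)) y≮0
  ... | no g≮0 = ℤP.≤-trans a≤-g (ℤP.neg-mono-≤ (ℤP.≮⇒≥ g≮0))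

isVertex-self : ∀ {n m} (k : Fin n) → isVertex {m = m} k (inj₁ k) ≡ true
isVertex-self k = dec-true (k ≟ᶠ k) refl

isVertex-other : ∀ {n m} {k i : Fin n} → k ≢ i → isVertex {m = m} k (inj₁ i) ≡ false
isVertex-other {k = k} {i} k≢i = dec-false (k ≟ᶠ i) k≢i

module _ {n m} (k : Fin n) (G : IceQuiver n m) where

  mutate-source : ∀ b → mutate k G (inj₁ k) b ≡ -ᶻ G (inj₁ k) b
  mutate-source b rewrite isVertex-self {m = m} k = refl

  mutate-target : ∀ a → mutate k G a (inj₁ k) ≡ -ᶻ G a (inj₁ k)
  mutate-target a rewrite isVertex-self {m = m} k | ∨-zeroʳ (isVertex k a) = refl

  mutate-elsewhere : ∀ a b → isVertex k a ≡ false → isVertex k b ≡ false →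
    mutate k G a b ≡ G a b +ᶻ pathTerm (G a (inj₁ k)) (G (inj₁ k) b)
  mutate-elsewhere a b a≠k b≠k rewrite a≠k | b≠k = refl

  mutate-skew : IsIceQuiver G → IsIceQuiver (mutate k G)
  mutate-skew skew a b with isVertex k a | isVertex k b
  ... | true | true = cong -ᶻ_ (skew a b)
  ... | true | false = cong -ᶻ_ (skew a b)
  ... | false | true = cong -ᶻ_ (skew a b)
  ... | false | false = begin
    G a b +ᶻ P                                              ≡⟨ cong₂ _+ᶻ_ (sym (ℤP.neg-involutive (G a b)))
                                                                             (sym (ℤP.neg-involutive P)) ⟩
    -ᶻ (-ᶻ G a b) +ᶻ -ᶻ (-ᶻ P)                               ≡⟨ sym (ℤP.neg-distrib-+ (-ᶻ G a b) (-ᶻ P)) ⟩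
    -ᶻ (-ᶻ G a b +ᶻ -ᶻ P)                                    ≡⟨ cong -ᶻ_ (cong₂ _+ᶻ_ (sym (skew b a))
                                                                  (sym (pathTerm-swap (G a (inj₁ k)) (G (inj₁ k) b)))) ⟩
    -ᶻ (G b a +ᶻ pathTerm (-ᶻ G (inj₁ k) b) (-ᶻ G a (inj₁ k))) ≡⟨ cong (λ t → -ᶻ (G b a +ᶻ t))
                                                                  (cong₂ pathTerm (sym (skew b (inj₁ k))) (sym (skew (inj₁ k) a))) ⟩
    -ᶻ (G b a +ᶻ pathTerm (G b (inj₁ k)) (G (inj₁ k) a))     ∎
    where
    open ≡-Reasoning
    P : ℤ
    P = pathTerm (G a (inj₁ k)) (G (inj₁ k) b)

mutateSeq-skew : ∀ {n m} ks (G : IceQuiver n m) → IsIceQuiver G → IsIceQuiver (mutateSeq ks G)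
mutateSeq-skew [] G skew = skew
mutateSeq-skew (k ∷ ks) G skew = mutateSeq-skew ks (mutate k G) (mutate-skew k G skew)

mutateSeq-++ : ∀ {n m} xs ys (G : IceQuiver n m) → mutateSeq (xs ++ ys) G ≡ mutateSeq ys (mutateSeq xs G)
mutateSeq-++ [] ys G = refl
mutateSeq-++ (x ∷ xs) ys G = mutateSeq-++ xs ys (mutate x G)

take-suc-tabulate : ∀ {A : Set} {n} (f : Fin n → A) (c : Fin n) →
  take (suc (toℕ c)) (tabulate f) ≡ take (toℕ c) (tabulate f) ++ (f c ∷ [])
take-suc-tabulate f Fin.zero = refl
take-suc-tabulate f (Fin.suc c) = cong (f Fin.zero ∷_) (take-suc-tabulate (f ∘ Fin.suc) c)

stage-suc : ∀ {n m} (G : IceQuiver (suc n) m) r v (c : Fin n) →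
  stage G r v (suc (toℕ c)) ≡ mutate (ordVertex r v c) (stage G r v (toℕ c))
stage-suc {n} G r v c = begin
  mutateSeq (map V (take (suc (toℕ c)) (allFin n))) G
    ≡⟨ cong (λ l → mutateSeq (map V l) G) (take-suc-tabulate id c) ⟩
  mutateSeq (map V (take (toℕ c) (allFin n) ++ (c ∷ []))) G
    ≡⟨ cong (λ l → mutateSeq l G) (map-++ V (take (toℕ c) (allFin n)) (c ∷ [])) ⟩
  mutateSeq (map V (take (toℕ c) (allFin n)) ++ (V c ∷ [])) G
    ≡⟨ mutateSeq-++ (map V (take (toℕ c) (allFin n))) (V c ∷ []) G ⟩
  mutate (V c) (stage G r v (toℕ c)) ∎
  where
  open ≡-Reasoning
  V = ordVertex r v

stepwise : ∀ {A : Set} (_R_ : A → A → Set) → Reflexive _R_ → Transitive _R_ → (s : ℕ → A) →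
  ∀ {i j} → i ≤ j → (∀ k → i ≤ k → k < j → s k R s (suc k)) → s i R s j
stepwise _R_ R-refl R-trans s {j = zero} z≤n steps = R-refl
stepwise _R_ R-refl R-trans s {i} {suc j} i≤1+j steps with ℕP.m≤n⇒m<n∨m≡n i≤1+j
... | inj₂ refl = R-refl
... | inj₁ (s≤s i≤j) =
  R-trans (stepwise _R_ R-refl R-trans s i≤j (λ k i≤k k<j → steps k i≤k (ℕP.m<n⇒m<1+n k<j)))
          (steps j i≤j ℕP.≤-refl)

injective⇒surjective : ∀ {n} (f : Fin n → Fin n) → Injective _≡_ _≡_ f → ∀ y → ∃ λ i → f i ≡ y
injective⇒surjective {suc n} f f-inj y with FinP.any? (λ i → f i ≟ᶠ y)
... | yes hit = hit
... | no miss = contradiction (FinP.injective⇒≤ g-inj) ℕP.1+n≰n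
  where
  y≢f : ∀ i → y ≢ f i
  y≢f i e = miss (i , sym e)
  g : Fin (suc n) → Fin n
  g i = punchOut (y≢f i)
  g-inj : Injective _≡_ _≡_ g
  g-inj {i} {j} e = f-inj (FinP.punchOut-injective (y≢f i) (y≢f j) e)

module _ {n} (Q : Quiver (suc n)) (r : Fin (suc n)) (r-sink : ∀ j → ¬ (+ 0 <ᶻ Q r j)) where

  private
    avoids-sink : ∀ {a b} → Path Q a b → r ≢ a
    avoids-sink (edge e) refl = r-sink _ e
    avoids-sink (step e _) refl = r-sink _ e

    edge-without-sink : ∀ {a b} (r≢a : r ≢ a) (r≢b : r ≢ b) → + 0 <ᶻ Q a b →
      + 0 <ᶻ delete r Q (punchOut r≢a) (punchOut r≢b)
    edge-without-sink r≢a r≢b =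
      subst₂ (λ x y → + 0 <ᶻ Q x y) (sym (FinP.punchIn-punchOut r≢a)) (sym (FinP.punchIn-punchOut r≢b))

    path-without-sink : ∀ {a b} (p : Path Q a b) (r≢b : r ≢ b) →
      Path (delete r Q) (punchOut (avoids-sink p)) (punchOut r≢b)
    path-without-sink (edge e) r≢b = edge (edge-without-sink _ r≢b e)
    path-without-sink (step e p) r≢b = step (edge-without-sink _ (avoids-sink p) e) (path-without-sink p r≢b)

  acyclic-deleting-sink : Acyclic (delete r Q) → Acyclic Q
  acyclic-deleting-sink acyclic a p = acyclic _ (path-without-sink p (avoids-sink p))

module ForkMutation {n m : ℕ} (F : IceQuiver (suc n) m) (r : Fin (suc n)) (v : Fin n → Fin n)
  (skew : IsIceQuiver F) (fork : IsFork (mutableSub F) r)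
  (ordering : IsAcyclicOrdering (delete r (mutableSub F)) v) where

  Q : Quiver (suc n)
  Q = mutableSub F

  abundant : Abundant Q
  abundant = proj₁ fork

  not-acyclic : ¬ Acyclic Q
  not-acyclic = proj₁ (proj₂ fork)

  returns : ∀ i j → + 0 <ᶻ Q i r → + 0 <ᶻ Q r j → (Q i r <ᶻ Q j i) × (Q r j <ᶻ Q j i)
  returns = proj₁ (proj₂ (proj₂ fork))

  acyclic-without-root : Acyclic (delete r Q)
  acyclic-without-root = proj₂ (proj₂ (proj₂ fork))

  arrow-≢ : ∀ {x y} → + 0 <ᶻ Q x y → y ≢ x
  arrow-≢ {x} x→y refl = ℤP.<-irrefl (sym (skew-zero _ (skew (inj₁ x) (inj₁ x)))) x→y

  V : Fin n → Fin (suc n)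
  V = ordVertex r v

  F^ : ℕ → IceQuiver (suc n) m
  F^ k = stage F r v k

  inner : ℕ → Fin n → Fin n → ℤ
  inner k a b = F^ k (inj₁ (V a)) (inj₁ (V b))

  fromRoot : ℕ → Fin n → ℤ
  fromRoot k b = F^ k (inj₁ r) (inj₁ (V b))

  frozenOfRoot : ℕ → Fin m → ℤ
  frozenOfRoot k f = F^ k (inj₁ r) (inj₂ f)

  frozenOf : ℕ → Fin n → Fin m → ℤ
  frozenOf k a f = F^ k (inj₁ (V a)) (inj₂ f)

  atTurn : (P : ℕ → Set) → (∀ c → P (toℕ c)) → ∀ k → k < n → P k
  atTurn P h k k<n = subst P (FinP.toℕ-fromℕ< k<n) (h (fromℕ< k<n))

  V-injective : Injective _≡_ _≡_ V
  V-injective e = proj₁ ordering (FinP.punchIn-injective r _ _ e)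

  V≢r : ∀ a → V a ≢ r
  V≢r a = FinP.punchInᵢ≢i r (v a)

  V-surjective : ∀ x → x ≢ r → ∃ λ b → V b ≡ x
  V-surjective x x≢r with injective⇒surjective v (proj₁ ordering) (punchOut (x≢r ∘ sym))
  ... | b , vb≡ = b , trans (cong (punchIn r) vb≡) (FinP.punchIn-punchOut (x≢r ∘ sym))

  F^-skew : ∀ k → IsIceQuiver (F^ k)
  F^-skew k = mutateSeq-skew (map V (take k (allFin n))) F skew

  F^-step : ∀ c x y → F^ (suc (toℕ c)) x y ≡ mutate (V c) (F^ (toℕ c)) x y
  F^-step c x y = cong (λ G → G x y) (stage-suc F r v c)

  isVertex-V-other : ∀ {a c} → a ≢ c → isVertex {m = m} (V c) (inj₁ (V a)) ≡ false
  isVertex-V-other {a} {c} a≢c = isVertex-other {m = m} {k = V c} {V a} (a≢c ∘ sym ∘ V-injective)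

  isVertex-root : ∀ c → isVertex {m = m} (V c) (inj₁ r) ≡ false
  isVertex-root c = isVertex-other {m = m} {k = V c} {r} (V≢r c)

  inner-step : ∀ c a b → a ≢ c → b ≢ c →
    inner (suc (toℕ c)) a b ≡ inner (toℕ c) a b +ᶻ pathTerm (inner (toℕ c) a c) (inner (toℕ c) c b)
  inner-step c a b a≢c b≢c = trans (F^-step c _ _)
    (mutate-elsewhere (V c) (F^ (toℕ c)) (inj₁ (V a)) (inj₁ (V b)) (isVertex-V-other a≢c) (isVertex-V-other b≢c))

  inner-step-source : ∀ c b → inner (suc (toℕ c)) c b ≡ -ᶻ inner (toℕ c) c b
  inner-step-source c b = trans (F^-step c _ _) (mutate-source (V c) (F^ (toℕ c)) (inj₁ (V b)))

  inner-step-target : ∀ c a → inner (suc (toℕ c)) a c ≡ -ᶻ inner (toℕ c) a c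
  inner-step-target c a = trans (F^-step c _ _) (mutate-target (V c) (F^ (toℕ c)) (inj₁ (V a)))

  fromRoot-step : ∀ c b → b ≢ c →
    fromRoot (suc (toℕ c)) b ≡ fromRoot (toℕ c) b +ᶻ pathTerm (fromRoot (toℕ c) c) (inner (toℕ c) c b)
  fromRoot-step c b b≢c = trans (F^-step c _ _)
    (mutate-elsewhere (V c) (F^ (toℕ c)) (inj₁ r) (inj₁ (V b)) (isVertex-root c) (isVertex-V-other b≢c))

  frozenOfRoot-step : ∀ c f →
    frozenOfRoot (suc (toℕ c)) f ≡ frozenOfRoot (toℕ c) f +ᶻ pathTerm (fromRoot (toℕ c) c) (frozenOf (toℕ c) c f)
  frozenOfRoot-step c f = trans (F^-step c _ _)
    (mutate-elsewhere (V c) (F^ (toℕ c)) (inj₁ r) (inj₂ f) (isVertex-root c) refl)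

  frozenOf-step : ∀ c a f → a ≢ c →
    frozenOf (suc (toℕ c)) a f ≡ frozenOf (toℕ c) a f +ᶻ pathTerm (inner (toℕ c) a c) (frozenOf (toℕ c) c f)
  frozenOf-step c a f a≢c = trans (F^-step c _ _)
    (mutate-elsewhere (V c) (F^ (toℕ c)) (inj₁ (V a)) (inj₂ f) (isVertex-V-other a≢c) refl)

  frozenOf-step-self : ∀ c f → frozenOf (suc (toℕ c)) c f ≡ -ᶻ frozenOf (toℕ c) c f
  frozenOf-step-self c f = trans (F^-step c _ _) (mutate-source (V c) (F^ (toℕ c)) (inj₂ f))

  arrows-opposite : ∀ x y → x ≢ y → ¬ (+ 0 <ᶻ Q y x) → + 2 ≤ᶻ Q x y
  arrows-opposite x y x≢y no-yx with abundant-sign (Q x y) (abundant x y x≢y)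
  ... | inj₁ 2≤xy = 2≤xy
  ... | inj₂ xy≤-2 =
    contradiction (two-positive (subst (+ 2 ≤ᶻ_) (sym (skew (inj₁ y) (inj₁ x))) (ℤP.neg-mono-≤ xy≤-2))) no-yx

  inner-forward : ∀ a b → toℕ a < toℕ b → + 2 ≤ᶻ inner 0 a b
  inner-forward a b a<b =
    arrows-opposite (V a) (V b) (FinP.<⇒≢ a<b ∘ V-injective) (λ b→a → ℕP.<-asym a<b (proj₂ ordering b a b→a))

  root-has-out-arrow : ∃ λ j → + 0 <ᶻ Q r j
  root-has-out-arrow with FinP.any? (λ j → + 0 ℤP.<? Q r j)
  ... | yes out = out
  ... | no none =
    contradiction (acyclic-deleting-sink Q r (λ j r→j → none (j , r→j)) acyclic-without-root) not-acyclic

  -- The point of return sends an arrow to the first vertex: otherwise its out-neighbour,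
  -- which by the fork condition precedes the first vertex, would come earlier still.
  root-to-first : ∀ c → toℕ c ≡ 0 → + 0 <ᶻ fromRoot 0 c
  root-to-first c c-first with + 0 ℤP.<? fromRoot 0 c | root-has-out-arrow
  ... | yes r→c | _ = r→c
  ... | no r↛c | j , r→j with V-surjective j (arrow-≢ r→j)
  ...   | b , refl = contradiction (subst (toℕ b <_) c-first (proj₂ ordering b c b→c)) ℕP.n≮0
    where
    c→r : + 0 <ᶻ Q (V c) r
    c→r = two-positive (arrows-opposite (V c) r (V≢r c) r↛c)
    b→c : + 0 <ᶻ inner 0 b c
    b→c = ℤP.<-trans c→r (proj₁ (returns (V c) (V b) c→r r→j))

  mutated : ℕ → Fin n → Bool
  mutated k a = does (toℕ a ℕP.<? k)

  mutated-zero : ∀ a → mutated 0 a ≡ false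
  mutated-zero a = dec-false (toℕ a ℕP.<? 0) ℕP.n≮0

  mutated-self : ∀ c → mutated (toℕ c) c ≡ false
  mutated-self c = dec-false (toℕ c ℕP.<? toℕ c) (ℕP.<-irrefl refl)

  mutated-suc-self : ∀ c → mutated (suc (toℕ c)) c ≡ true
  mutated-suc-self c = dec-true (toℕ c ℕP.<? suc (toℕ c)) (ℕP.n<1+n (toℕ c))

  mutated-suc-other : ∀ {a c} → a ≢ c → mutated (suc (toℕ c)) a ≡ mutated (toℕ c) a
  mutated-suc-other {a} {c} a≢c with toℕ a ℕP.<? toℕ c
  ... | yes a<c = trans (dec-true (toℕ a ℕP.<? suc (toℕ c)) (ℕP.m<n⇒m<1+n a<c))
                        (sym (dec-true (toℕ a ℕP.<? toℕ c) a<c))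
  ... | no a≮c = trans (dec-false (toℕ a ℕP.<? suc (toℕ c)) a≮1+c) (sym (dec-false (toℕ a ℕP.<? toℕ c) a≮c))
    where
    a≮1+c : ¬ (toℕ a < suc (toℕ c))
    a≮1+c a<1+c = a≮c (FinP.≤∧≢⇒< (ℕP.≤-pred a<1+c) a≢c)

  -- Each v_c is a source of F^c ∖ r, so mutating at it creates no paths through it and only
  -- reverses its arrows: the arrow v_a → v_b has been reversed once per mutated endpoint.
  SignPattern : ℕ → Set
  SignPattern k = ∀ a b → a ≢ b → inner k a b ≡ negateIf (mutated k a) (negateIf (mutated k b) (inner 0 a b))

  signPattern-zero : SignPattern 0
  signPattern-zero a b _ rewrite mutated-zero a | mutated-zero b = refl

  module _ (c : Fin n) (signs : SignPattern (toℕ c)) where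

    pattern-source : ∀ b → b ≢ c → + 2 ≤ᶻ inner (toℕ c) c b
    pattern-source b b≢c rewrite signs c b (b≢c ∘ sym) | mutated-self c with toℕ b ℕP.<? toℕ c
    ... | yes b<c rewrite dec-true (toℕ b ℕP.<? toℕ c) b<c =
          subst (+ 2 ≤ᶻ_) (F^-skew 0 _ _) (inner-forward b c b<c)
    ... | no b≮c rewrite dec-false (toℕ b ℕP.<? toℕ c) b≮c =
          inner-forward c b (FinP.≤∧≢⇒< (ℕP.≮⇒≥ b≮c) (b≢c ∘ sym))

    pattern-sink : ∀ a → a ≢ c → inner (toℕ c) a c ≤ᶻ -[1+ 1 ]
    pattern-sink a a≢c =
      subst (_≤ᶻ -[1+ 1 ]) (sym (F^-skew (toℕ c) _ _)) (ℤP.neg-mono-≤ (pattern-source a a≢c))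

    signPattern-step : SignPattern (suc (toℕ c))
    signPattern-step a b a≢b with a ≟ᶠ c | b ≟ᶠ c
    ... | yes refl | yes refl = contradiction refl a≢b
    ... | yes refl | no b≢c
      rewrite inner-step-source c b | signs c b a≢b
            | mutated-self c | mutated-suc-self c | mutated-suc-other b≢c = refl
    ... | no a≢c | yes refl
      rewrite inner-step-target c a | signs a c a≢b
            | mutated-self c | mutated-suc-self c | mutated-suc-other a≢c =
          sym (negateIf-neg (mutated (toℕ c) a) (inner 0 a c))
    ... | no a≢c | no b≢c
      rewrite inner-step c a b a≢c b≢c
            | pathTerm-zero (inner (toℕ c) a c) (inner (toℕ c) c b)
                (ℤP.≤-<-trans (pattern-sink a a≢c) -<+) (ℤP.<⇒≤ (two-positive (pattern-source b b≢c)))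
            | ℤP.+-identityʳ (inner (toℕ c) a b) | signs a b a≢b
            | mutated-suc-other a≢c | mutated-suc-other b≢c = refl

  signPattern : ∀ k → k ≤ n → SignPattern k
  signPattern zero _ = signPattern-zero
  signPattern (suc k) k<n =
    atTurn (λ k → SignPattern k → SignPattern (suc k)) signPattern-step k k<n (signPattern k (ℕP.<⇒≤ k<n))

  signPattern-at-turn : ∀ c → SignPattern (toℕ c)
  signPattern-at-turn c = signPattern (toℕ c) (ℕP.<⇒≤ (FinP.toℕ<n c))

  turn-sink : ∀ c a → a ≢ c → inner (toℕ c) a c ≤ᶻ -[1+ 1 ]
  turn-sink c = pattern-sink c (signPattern-at-turn c)

  RootBeforeTurn : ℕ → Set
  RootBeforeTurn k = ∀ b → k ≤ toℕ b → + 0 <ᶻ fromRoot k b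

  root-first-turn : ∀ c → toℕ c ≡ 0 → RootBeforeTurn (suc (toℕ c))
  root-first-turn c c-first b c<b rewrite fromRoot-step c b (FinP.<⇒≢ c<b ∘ sym) | c-first =
    pathTerm-positive (fromRoot 0 c) (inner 0 c b) (fromRoot 0 b) (root-to-first c c-first) returned
    where
    c→b : + 0 <ᶻ inner 0 c b
    c→b = two-positive (inner-forward c b (subst (_< toℕ b) (sym c-first) c<b))
    returned : + 0 <ᶻ fromRoot 0 b ⊎ (+ 0 <ᶻ inner 0 c b × -ᶻ fromRoot 0 b <ᶻ inner 0 c b)
    returned with + 0 ℤP.<? fromRoot 0 b
    ... | yes r→b = inj₁ r→b
    ... | no r↛b = inj₂ (c→b , subst (_<ᶻ inner 0 c b) (skew (inj₁ (V b)) (inj₁ r))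
                    (proj₁ (returns (V b) (V c) b→r (root-to-first c c-first))))
      where
      b→r : + 0 <ᶻ Q (V b) r
      b→r = two-positive (arrows-opposite (V b) r (V≢r b) r↛b)

  root-later-turn : ∀ c → RootBeforeTurn (toℕ c) → RootBeforeTurn (suc (toℕ c))
  root-later-turn c before b c<b rewrite fromRoot-step c b (FinP.<⇒≢ c<b ∘ sym) =
    pathTerm-positive (fromRoot (toℕ c) c) (inner (toℕ c) c b) (fromRoot (toℕ c) b)
      (before c ℕP.≤-refl) (inj₁ (before b (ℕP.<⇒≤ c<b)))

  rootBeforeTurn : ∀ k → k < n → RootBeforeTurn (suc k)
  rootBeforeTurn zero 0<n = atTurn (λ k → k ≡ 0 → RootBeforeTurn (suc k)) root-first-turn 0 0<n refl
  rootBeforeTurn (suc k) 1+k<n =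
    atTurn (λ k → RootBeforeTurn k → RootBeforeTurn (suc k)) root-later-turn (suc k) 1+k<n
      (rootBeforeTurn k (ℕP.<⇒≤ 1+k<n))

  root-to-current : ∀ c → + 0 <ᶻ fromRoot (toℕ c) c
  root-to-current c with toℕ c in c-index
  ... | zero = root-to-first c c-index
  ... | suc k =
    rootBeforeTurn k (ℕP.<⇒≤ (subst (_< n) c-index (FinP.toℕ<n c))) c (ℕP.≤-reflexive (sym c-index))

  frozenOfRoot-nondecreasing : ∀ c f → frozenOfRoot (toℕ c) f ≤ᶻ frozenOfRoot (suc (toℕ c)) f
  frozenOfRoot-nondecreasing c f rewrite frozenOfRoot-step c f =
    ≤-+-nonneg (frozenOfRoot (toℕ c) f) (pathTerm-nonneg _ _ (root-to-current c))

  frozenOfRoot-increasing : ∀ c f → + 0 <ᶻ frozenOf (toℕ c) c f →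
    frozenOfRoot (toℕ c) f <ᶻ frozenOfRoot (suc (toℕ c)) f
  frozenOfRoot-increasing c f c→f rewrite frozenOfRoot-step c f =
    <-+-pos (frozenOfRoot (toℕ c) f) (ℤP.<-≤-trans c→f (pathTerm-≥ʳ _ _ (root-to-current c) c→f))

  frozenOfRoot-monotone : ∀ f {i j} → i ≤ j → j ≤ n → frozenOfRoot i f ≤ᶻ frozenOfRoot j f
  frozenOfRoot-monotone f i≤j j≤n =
    stepwise _≤ᶻ_ ℤP.≤-refl ℤP.≤-trans (λ k → frozenOfRoot k f) i≤j
      λ k _ k<j → atTurn (λ k → frozenOfRoot k f ≤ᶻ frozenOfRoot (suc k) f)
                    (λ c → frozenOfRoot-nondecreasing c f) k (ℕP.<-≤-trans k<j j≤n)

  frozenOf-nonincreasing : ∀ c a f → a ≢ c → frozenOf (suc (toℕ c)) a f ≤ᶻ frozenOf (toℕ c) a f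
  frozenOf-nonincreasing c a f a≢c rewrite frozenOf-step c a f a≢c =
    +-nonpos-≤ (frozenOf (toℕ c) a f) (pathTerm-nonpos _ _ (ℤP.≤-<-trans (turn-sink c a a≢c) -<+))

  frozenOf-antitone : ∀ a f {i j} → i ≤ j → j ≤ n → (∀ k → i ≤ k → k < j → toℕ a ≢ k) →
    frozenOf j a f ≤ᶻ frozenOf i a f
  frozenOf-antitone a f i≤j j≤n untouched =
    stepwise (flip _≤ᶻ_) ℤP.≤-refl (flip ℤP.≤-trans) (λ k → frozenOf k a f) i≤j
      λ k i≤k k<j → atTurn (λ k → toℕ a ≢ k → frozenOf (suc k) a f ≤ᶻ frozenOf k a f)
                      (λ c a≢c → frozenOf-nonincreasing c a f (a≢c ∘ cong toℕ)) k (ℕP.<-≤-trans k<j j≤n)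
                      (untouched k i≤k k<j)

  frozenOf-drops-twice : ∀ c a f → a ≢ c → frozenOf (toℕ c) c f <ᶻ + 0 →
    frozenOf (suc (toℕ c)) a f ≤ᶻ frozenOf (toℕ c) a f +ᶻ (frozenOf (toℕ c) c f +ᶻ frozenOf (toℕ c) c f)
  frozenOf-drops-twice c a f a≢c c↚f rewrite frozenOf-step c a f a≢c =
    ℤP.+-monoʳ-≤ (frozenOf (toℕ c) a f) (pathTerm-≤-double _ _ (turn-sink c a a≢c) c↚f)

  green-root-stays-green : ∀ j → j ≤ n → Green F r → Green (F^ j) r
  green-root-stays-green j j≤n ((f , r→f) , r→frozen) =
    (f , ℤP.<-≤-trans r→f (grows f)) , λ f′ → ℤP.≤-trans (r→frozen f′) (grows f′)
    where
    grows : ∀ f → frozenOfRoot 0 f ≤ᶻ frozenOfRoot j f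
    grows f = frozenOfRoot-monotone f z≤n j≤n

  blue-root-receives : Blue F r → ∀ {j} → j ≤ n → ∀ i f → toℕ i < j →
    + 0 <ᶻ frozenOf (toℕ i) i f → + 0 <ᶻ frozenOfRoot j f
  blue-root-receives blue {j} j≤n i f i<j i→f = begin-strict
    + 0                          ≡⟨ sym (blue f) ⟩
    frozenOfRoot 0 f             ≤⟨ frozenOfRoot-monotone f z≤n (ℕP.<⇒≤ (FinP.toℕ<n i)) ⟩
    frozenOfRoot (toℕ i) f       <⟨ frozenOfRoot-increasing i f i→f ⟩
    frozenOfRoot (suc (toℕ i)) f ≤⟨ frozenOfRoot-monotone f i<j j≤n ⟩
    frozenOfRoot j f             ∎
    where open ℤP.≤-Reasoning

  blue-root : ∀ j → j ≤ n → Blue F r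
    → (Blue (F^ j) r → ∀ i → toℕ i < j → ¬ Green (F^ (toℕ i)) (V i))
      × ((∃ λ i → toℕ i < j × Green (F^ (toℕ i)) (V i)) → Green (F^ j) r)
  blue-root j j≤n blue =
    (λ { blue-j i i<j ((f , i→f) , _) → ℤP.<-irrefl (sym (blue-j f)) (blue-root-receives blue j≤n i f i<j i→f) })
    , λ { (i , i<j , ((f , i→f) , _)) →
          (f , blue-root-receives blue j≤n i f i<j i→f)
          , λ f′ → subst (_≤ᶻ frozenOfRoot j f′) (blue f′) (frozenOfRoot-monotone f′ z≤n j≤n) }

  module LastTurn (l : Fin n) (red : Red F (V l)) where

    l≤n : toℕ l ≤ n
    l≤n = ℕP.<⇒≤ (FinP.toℕ<n l)

    f₀ : Fin m
    f₀ = proj₁ (proj₁ red)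

    decreasing-before-turn : ∀ f {k} → k ≤ toℕ l → frozenOf k l f ≤ᶻ frozenOf 0 l f
    decreasing-before-turn f k≤l = frozenOf-antitone l f z≤n (ℕP.≤-trans k≤l l≤n)
      λ k′ _ k′<k l≡k′ → ℕP.<-irrefl (sym l≡k′) (ℕP.<-≤-trans k′<k k≤l)

    nonpos-before-turn : ∀ f {k} → k ≤ toℕ l → frozenOf k l f ≤ᶻ + 0
    nonpos-before-turn f k≤l = ℤP.≤-trans (decreasing-before-turn f k≤l) (proj₂ red f)

    negative-at-turn : frozenOf (toℕ l) l f₀ <ᶻ + 0
    negative-at-turn = ℤP.≤-<-trans (decreasing-before-turn f₀ ℕP.≤-refl) (proj₂ (proj₁ red))

    green-after-turn : Green (F^ (suc (toℕ l))) (V l)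
    green-after-turn =
      (f₀ , subst (+ 0 <ᶻ_) (sym (frozenOf-step-self l f₀))
              (ℤP.neg-mono-< negative-at-turn))
      , λ f → subst (+ 0 ≤ᶻ_) (sym (frozenOf-step-self l f))
                (ℤP.neg-mono-≤ (nonpos-before-turn f ℕP.≤-refl))

    earlier-after-turn : ∀ i f → toℕ i < toℕ l →
      (frozenOf (suc (toℕ l)) i f ≤ᶻ + 0) × (frozenOf (toℕ l) l f <ᶻ + 0 → frozenOf (suc (toℕ l)) i f <ᶻ + 0)
    earlier-after-turn i f i<l rewrite frozenOf-step l i f (FinP.<⇒≢ i<l) =
      nonpos-after-last-turn (frozenOf (toℕ l) i f) g (inner (toℕ l) i l) (frozenOf (toℕ l) l f)
        reversed (turn-sink l i (FinP.<⇒≢ i<l))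
        (nonpos-before-turn f ℕP.≤-refl) doubled
      where
      g : ℤ
      g = frozenOf (toℕ i) i f
      reversed : frozenOf (toℕ l) i f ≤ᶻ -ᶻ g
      reversed = subst (frozenOf (toℕ l) i f ≤ᶻ_) (frozenOf-step-self i f)
        (frozenOf-antitone i f i<l l≤n λ k 1+i≤k _ → ℕP.<⇒≢ 1+i≤k)
      doubled : g <ᶻ + 0 → frozenOf (toℕ l) l f ≤ᶻ g +ᶻ g
      doubled g<0 = begin
        frozenOf (toℕ l) l f             ≤⟨ frozenOf-antitone l f i<l l≤n (λ k _ k<l l≡k → ℕP.<-irrefl (sym l≡k) k<l) ⟩
        frozenOf (suc (toℕ i)) l f       ≤⟨ frozenOf-drops-twice i l f (FinP.<⇒≢ i<l ∘ sym) g<0 ⟩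
        frozenOf (toℕ i) l f +ᶻ (g +ᶻ g) ≤⟨ ℤP.+-monoˡ-≤ (g +ᶻ g) (nonpos-before-turn f (ℕP.<⇒≤ i<l)) ⟩
        + 0 +ᶻ (g +ᶻ g)                  ≡⟨ ℤP.+-identityˡ (g +ᶻ g) ⟩
        g +ᶻ g                           ∎
        where open ℤP.≤-Reasoning

    earlier-red-after-turn : ∀ i → toℕ i < toℕ l → Red (F^ (suc (toℕ l))) (V i)
    earlier-red-after-turn i i<l =
      (f₀ , proj₂ (earlier-after-turn i f₀ i<l) negative-at-turn)
      , λ f → proj₁ (earlier-after-turn i f i<l)

  last-vertex : ∀ l → suc (toℕ l) ≡ n → Red F (V l)
    → Green (F^ n) (V l) × (∀ x → x ≢ r → x ≢ V l → Red (F^ n) x)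
  last-vertex l last red =
    subst (λ k → Green (F^ k) (V l) × (∀ x → x ≢ r → x ≢ V l → Red (F^ k) x)) last (green-after-turn , others)
    where
    open LastTurn l red
    others : ∀ x → x ≢ r → x ≢ V l → Red (F^ (suc (toℕ l))) x
    others x x≢r x≢l with V-surjective x x≢r
    ... | i , refl = earlier-red-after-turn i
          (FinP.≤∧≢⇒< (ℕP.≤-pred (subst (toℕ i <_) (sym last) (FinP.toℕ<n i))) (x≢l ∘ cong V))

corollary4p6 : ∀ {n m} (F : IceQuiver (suc n) m) (r : Fin (suc n)) (v : Fin n → Fin n)
  → IsIceQuiver F
  → UniformlySignCoherent F
  → IsFork (mutableSub F) r
  → IsAcyclicOrdering (delete r (mutableSub F)) v
  → (∀ j → j ≤ n → Red F r
       → Red (stage F r v j) r ⊎ Green (stage F r v j) r ⊎ Blue (stage F r v j) r)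
    × (∀ j → j ≤ n → Green F r → Green (stage F r v j) r)
    × (∀ j → j ≤ n → Blue F r
       → (Blue (stage F r v j) r
            → ∀ (i : Fin n) → toℕ i < j → ¬ Green (stage F r v (toℕ i)) (ordVertex r v i))
         × ((∃ λ (i : Fin n) → toℕ i < j × Green (stage F r v (toℕ i)) (ordVertex r v i))
            → Green (stage F r v j) r))
    × (∀ (l : Fin n) → suc (toℕ l) ≡ n → Red F (ordVertex r v l)
       → Green (stage F r v n) (ordVertex r v l)
         × (∀ x → x ≢ r → x ≢ ordVertex r v l → Red (stage F r v n) x))
corollary4p6 {n} F r v skew coherent fork ordering =
  (λ j _ _ → proj₁ coherent (map (ordVertex r v) (take j (allFin n))) r)
  , green-root-stays-green , blue-root , last-vertex
  where open ForkMutation F r v skew fork ordering
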